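{- Let $n>0$, $\varepsilon,\gamma\geq0$, $d\in(0,1]$ and $s\in\mathbb{N}$. Let $G$ be an $(\varepsilon,s,D)$-typical graph with vertex partition $(V_1,\dots,V_t)$ such that $dn\leq|V_i|\leq n$ for all $i\in[t]$ and such that every entry of $D$ is either $0$ or at least $d$. Suppose $L$ is a graph on $V(G)$ such that for all $i,j\in[t]$, whenever $L$ has an edge between $V_i$ and $V_j$ (inside $V_i$ if $i=j$), then so does $G$; and suppose $\Delta(L)\leq\gamma n$. Then the graph $G\triangle L$ (vertex set $V(G)$, edge set the symmetric difference of $E(G)$ and $E(L)$) is $(\varepsilon+s\gamma d^{ -s-1},s,D)$-typical.
   Context: Let $G$ be a graph with vertex partition $(V_1,\dots,V_t)$ (parts need not be independent) and let $\tau(v)$ denote the index with $v\in V_{\tau(v)}$. For a symmetric matrix $D\in[0,1]^{t\times t}$, $s\in\mathbb{N}$, $\varepsilon\ge 0$, $G$ is $(\varepsilon,s,D)$-typical if for every $S\subseteq V(G)$ with $|S|\leq s$ and every $i\in[t]$, $|V_i\cap\bigcap_{v\in S}N_G(v)|=(1\pm\varepsilon)|V_i|\prod_{v\in S}D_{\tau(v)i}$, where $a=b\pm c$ means $a\in[b-c,b+c]$.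
   Formalization: The parameters n, ε, γ and d and the entries of D are rational. -}

module Defs where

open import Data.Bool using (Bool; true; false; if_then_else_; _xor_; _∧_)
open import Data.Nat using (ℕ; zero; suc)
import Data.Nat as ℕ
open import Data.Integer using (+_)
open import Data.Fin using (Fin; zero; suc)
open import Data.Fin.Subset using (Subset; ∣_∣)
open import Data.Vec using ([]; _∷_)
open import Data.Rational using (ℚ; 0ℚ; 1ℚ; _+_; _*_; _-_; _≤_; _<_; _/_; 1/_; positive)
open import Data.Rational.Properties using (pos⇒nonZero)
open import Relation.Nullary.Decidable using (isYes)
open import Data.Fin using (_≟_)
open import Data.Product using (Σ; _×_)
open import Function using (_∘_)
open import Relation.Binary.PropositionalEquality using (_≡_; refl)

ℕ→ℚ : ℕ → ℚ
ℕ→ℚ n = + n / 1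

_^_ : ℚ → ℕ → ℚ
p ^ zero = 1ℚ
p ^ suc k = p * (p ^ k)

inv : (d : ℚ) → 0ℚ < d → ℚ
inv d d>0 = (1/ d) {{pos⇒nonZero d {{positive d>0}}}}

count : ∀ {N} → (Fin N → Bool) → ℕ
count {zero} f = 0
count {suc N} f = (if f zero then 1 else 0) ℕ.+ count (f ∘ suc)

prodOver : ∀ {N} → Subset N → (Fin N → ℚ) → ℚ
prodOver [] f = 1ℚ
prodOver (b ∷ S) f = (if b then f zero else 1ℚ) * prodOver S (f ∘ suc)

allIn : ∀ {N} → Subset N → (Fin N → Bool) → Bool
allIn [] f = true
allIn (b ∷ S) f = (if b then f zero else true) ∧ allIn S (f ∘ suc)

record Graph (N : ℕ) : Set where
  field
    adj    : Fin N → Fin N → Bool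
    sym    : ∀ u v → adj u v ≡ adj v u
    irrefl : ∀ v → adj v v ≡ false
open Graph public

xor-sym : ∀ a b c d → a ≡ c → b ≡ d → (a xor b) ≡ (c xor d)
xor-sym a b .a .b refl refl = refl

xor-ff : ∀ a b → a ≡ false → b ≡ false → (a xor b) ≡ false
xor-ff .false .false refl refl = refl

_△_ : ∀ {N} → Graph N → Graph N → Graph N
adj (G △ L) u v = adj G u v xor adj L u v
sym (G △ L) u v = xor-sym _ _ _ _ (sym G u v) (sym L u v)
irrefl (G △ L) v = xor-ff _ _ (irrefl G v) (irrefl L v)

partSize : ∀ {N t} → (τ : Fin N → Fin t) → Fin t → ℕ
partSize τ i = count (λ v → isYes (τ v ≟ i))

commonNbrs : ∀ {N t} → Graph N → (τ : Fin N → Fin t) → Subset N → Fin t → ℕ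
commonNbrs G τ S i =
  count (λ v → isYes (τ v ≟ i) ∧ allIn S (λ u → adj G u v))

-- (ε, s, D)-typical w.r.t. vertex partition τ : a = b ± c  means b - c ≤ a ≤ b + c
Typical : ∀ {N t} → Graph N → (τ : Fin N → Fin t) → ℚ → ℕ → (Fin t → Fin t → ℚ) → Set
Typical {N} G τ ε s D =
  ∀ (S : Subset N) → ∣ S ∣ ℕ.≤ s → ∀ i →
    let b = ℕ→ℚ (partSize τ i) * prodOver S (λ u → D (τ u) i)
        c = ε * b
    in (b - c ≤ ℕ→ℚ (commonNbrs G τ S i)) × (ℕ→ℚ (commonNbrs G τ S i) ≤ b + c)

HasEdgeBetween : ∀ {N t} → Graph N → (τ : Fin N → Fin t) → Fin t → Fin t → Set
HasEdgeBetween {N} G τ i j =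
  Σ (Fin N) λ u → Σ (Fin N) λ v → τ u ≡ i × τ v ≡ j × adj G u v ≡ true

degree : ∀ {N} → Graph N → Fin N → ℕ
degree G v = count (adj G v)

{-# OPTIONS --safe #-}
-- Fix S with |S| ≤ s and a part V_i, and let p = ∏_{u∈S} D_{τ(u)i}. If some factor D_{τ(u)i}
-- vanishes, typicality applied to singletons shows that G has no edge between V_{τ(u)} and V_i,
-- hence neither has L; so u has no neighbour in V_i in G △ L and both sides of the estimate are 0.
-- Otherwise p ≥ d^s, so the expected count |V_i| p is at least d^{s+1} n. A common neighbour gained
-- or lost when passing from G to G △ L is an L-neighbour of some u ∈ S, so the two counts differ by
-- at most Σ_{u∈S} deg_L(u) ≤ sγn ≤ sγ d^{-s-1} |V_i| p.
module Submission where

open import Defs hiding (sym)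
open import Data.Nat using (ℕ; suc)
open import Data.Fin using (Fin)
open import Data.Rational using (ℚ; 0ℚ; 1ℚ; _+_; _*_; _≤_; _<_)
open import Data.Product using (_×_)
open import Data.Sum using (_⊎_)
open import Relation.Binary.PropositionalEquality using (_≡_)

open import Algebra.Properties.CommutativeSemigroup as CommSemigroup using ()
open import Data.Bool using (Bool; true; false; if_then_else_; _xor_; _∧_)
open import Data.Bool.Properties using (∧-assoc; ∧-zeroʳ; ∧-identityʳ)
open import Data.Empty using (⊥-elim)
open import Data.Fin using (zero; suc; _≟_)
open import Data.Fin.Properties using (any?)
open import Data.Fin.Subset using (Subset; ∣_∣; _∈_; ⁅_⁆; ⊥)
open import Data.Fin.Subset.Properties using (_∈?_; x∈⁅x⁆; ∣⁅x⁆∣≡1; x∈p⇒∣p-x∣<∣p∣)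
open import Data.Integer using (+_)
import Data.Integer as ℤ
import Data.Integer.Properties as ℤP
import Data.Nat as ℕ
open import Data.Nat using (zero; z≤n; s≤s)
import Data.Nat.Properties as ℕP
open import Data.Nat.Coprimality using (1-coprimeTo) renaming (sym to coprime-sym)
open import Data.Product using (∃; _,_; proj₁; proj₂)
open import Data.Rational using (_-_; -_; _/_; mkℚ; *≤*; nonNegative; positive)
import Data.Rational.Properties as QP
open import Data.Rational.Solver using (module +-*-Solver)
open +-*-Solver using (solve; _:+_; _:-_; _:*_; :-_; _:=_; con)
open import Data.Sum using (inj₁; inj₂)
open import Data.Vec using (_∷_; []; here; there)
open import Function using (_∘_)
open import Relation.Nullary using (Dec; yes; no)
open import Relation.Nullary.Decidable using (isYes; isYes≗does; dec-true; _×-dec_)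
open import Relation.Binary.PropositionalEquality
  using (refl; sym; trans; cong; cong₂; subst; subst₂; module ≡-Reasoning)

open CommSemigroup ℕP.+-commutativeSemigroup using (interchange)

variable
  M N t : ℕ

ℕ→ℚ≡mkℚ : ∀ n → ℕ→ℚ n ≡ mkℚ (+ n) 0 (coprime-sym (1-coprimeTo n))
ℕ→ℚ≡mkℚ n = QP.normalize-coprime (coprime-sym (1-coprimeTo n))

ℕ→ℚ-+ : ∀ a b → ℕ→ℚ (a ℕ.+ b) ≡ ℕ→ℚ a + ℕ→ℚ b
ℕ→ℚ-+ a b = sym (begin
  ℕ→ℚ a + ℕ→ℚ b                       ≡⟨ cong₂ _+_ (ℕ→ℚ≡mkℚ a) (ℕ→ℚ≡mkℚ b) ⟩
  (+ a ℤ.* + 1 ℤ.+ + b ℤ.* + 1) / 1   ≡⟨ cong₂ (λ x y → (x ℤ.+ y) / 1) (ℤP.*-identityʳ (+ a)) (ℤP.*-identityʳ (+ b)) ⟩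
  ℕ→ℚ (a ℕ.+ b)                       ∎)
  where open ≡-Reasoning

ℕ→ℚ-mono-≤ : ∀ {a b} → a ℕ.≤ b → ℕ→ℚ a ≤ ℕ→ℚ b
ℕ→ℚ-mono-≤ {a} {b} a≤b rewrite ℕ→ℚ≡mkℚ a | ℕ→ℚ≡mkℚ b =
  *≤* (subst₂ ℤ._≤_ (sym (ℤP.*-identityʳ (+ a))) (sym (ℤP.*-identityʳ (+ b))) (ℤ.+≤+ a≤b))

ℕ→ℚ-cancel-≤ : ∀ {a b} → ℕ→ℚ a ≤ ℕ→ℚ b → a ℕ.≤ b
ℕ→ℚ-cancel-≤ {a} {b} a≤b rewrite ℕ→ℚ≡mkℚ a | ℕ→ℚ≡mkℚ b with a≤b
... | *≤* a≤b = ℤP.drop‿+≤+ (subst₂ ℤ._≤_ (ℤP.*-identityʳ (+ a)) (ℤP.*-identityʳ (+ b)) a≤b)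

ℕ→ℚ-mono-≤-+ : ∀ {a} b c → a ℕ.≤ b ℕ.+ c → ℕ→ℚ a ≤ ℕ→ℚ b + ℕ→ℚ c
ℕ→ℚ-mono-≤-+ b c a≤b+c = QP.≤-trans (ℕ→ℚ-mono-≤ a≤b+c) (QP.≤-reflexive (ℕ→ℚ-+ b c))

ℕ→ℚ-nonNeg : ∀ k → 0ℚ ≤ ℕ→ℚ k
ℕ→ℚ-nonNeg k = ℕ→ℚ-mono-≤ {0} {k} z≤n

*-nonNeg : ∀ {p q} → 0ℚ ≤ p → 0ℚ ≤ q → 0ℚ ≤ p * q
*-nonNeg {p} {q} 0≤p 0≤q =
  QP.nonNegative⁻¹ _ {{QP.nonNeg*nonNeg⇒nonNeg p {{nonNegative 0≤p}} q {{nonNegative 0≤q}}}}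

*-mono-≤-nonNeg : ∀ {p q r u} → 0ℚ ≤ p → 0ℚ ≤ r → p ≤ q → r ≤ u → p * r ≤ q * u
*-mono-≤-nonNeg {p} {q} {r} {u} 0≤p 0≤r p≤q r≤u =
  QP.≤-trans (QP.*-monoʳ-≤-nonNeg r {{nonNegative 0≤r}} p≤q)
             (QP.*-monoˡ-≤-nonNeg q {{nonNegative (QP.≤-trans 0≤p p≤q)}} r≤u)

*-≤-by-inverse : ∀ {x y c c⁻¹ b} → 0ℚ ≤ x → 0ℚ ≤ c⁻¹ → c⁻¹ * c ≡ 1ℚ → c * y ≤ b →
  x * y ≤ x * c⁻¹ * b
*-≤-by-inverse {x} {y} {c} {c⁻¹} {b} 0≤x 0≤c⁻¹ c⁻¹c≡1 cy≤b = begin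
  x * y                    ≡⟨ cong (x *_) (QP.*-identityˡ y) ⟨
  x * (1ℚ * y)             ≡⟨ cong (λ z → x * (z * y)) c⁻¹c≡1 ⟨
  x * ((c⁻¹ * c) * y)      ≡⟨ solve 4 (λ x y c c⁻¹ → x :* ((c⁻¹ :* c) :* y) := (x :* c⁻¹) :* (c :* y))
                                      refl x y c c⁻¹ ⟩
  x * c⁻¹ * (c * y)        ≤⟨ QP.*-monoˡ-≤-nonNeg (x * c⁻¹) {{nonNegative (*-nonNeg 0≤x 0≤c⁻¹)}} cy≤b ⟩
  x * c⁻¹ * b              ∎
  where open QP.≤-Reasoning

_≈_±_ : ℚ → ℚ → ℚ → Set
a ≈ b ± c = (b - c ≤ a) × (a ≤ b + c)

≈±-widen : ∀ {a a′ b c x δ} → a ≈ b ± c → a′ ≤ a + x → a ≤ a′ + x → x ≤ δ → a′ ≈ b ± (c + δ)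
≈±-widen {a} {a′} {b} {c} {x} {δ} (b-c≤a , a≤b+c) a′≤a+x a≤a′+x x≤δ = lower , upper
  where
  open QP.≤-Reasoning
  lower : b - (c + δ) ≤ a′
  lower = begin
    b - (c + δ)        ≡⟨ solve 3 (λ b c δ → b :- (c :+ δ) := (b :- c) :+ (:- δ)) refl b c δ ⟩
    (b - c) + (- δ)    ≤⟨ QP.+-mono-≤ b-c≤a (QP.neg-antimono-≤ x≤δ) ⟩
    a + (- x)          ≤⟨ QP.+-monoˡ-≤ (- x) a≤a′+x ⟩
    (a′ + x) + (- x)   ≡⟨ solve 2 (λ a′ x → (a′ :+ x) :+ (:- x) := a′) refl a′ x ⟩
    a′                 ∎
  upper : a′ ≤ b + (c + δ)
  upper = begin
    a′                 ≤⟨ a′≤a+x ⟩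
    a + x              ≤⟨ QP.+-mono-≤ a≤b+c x≤δ ⟩
    (b + c) + δ        ≡⟨ QP.+-assoc b c δ ⟩
    b + (c + δ)        ∎

≈±-zero : ∀ {b} e → b ≡ 0ℚ → 0ℚ ≈ b ± (e * b)
≈±-zero e refl rewrite QP.*-zeroʳ e = QP.≤-refl , QP.≤-refl

≈zero±⇒≤0 : ∀ {a b} e → b ≡ 0ℚ → a ≈ b ± (e * b) → a ≤ 0ℚ
≈zero±⇒≤0 e refl (_ , a≤0+e*0) rewrite QP.*-zeroʳ e = a≤0+e*0

^-nonNeg : ∀ {d} → 0ℚ ≤ d → ∀ k → 0ℚ ≤ d ^ k
^-nonNeg 0≤d zero    = QP.<⇒≤ (QP.positive⁻¹ 1ℚ)
^-nonNeg 0≤d (suc k) = *-nonNeg 0≤d (^-nonNeg 0≤d k)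

^-≤-1 : ∀ {d} → 0ℚ ≤ d → d ≤ 1ℚ → ∀ k → d ^ k ≤ 1ℚ
^-≤-1 0≤d d≤1 zero    = QP.≤-refl
^-≤-1 0≤d d≤1 (suc k) =
  QP.≤-trans (*-mono-≤-nonNeg 0≤d (^-nonNeg 0≤d k) d≤1 (^-≤-1 0≤d d≤1 k)) (QP.≤-reflexive (QP.*-identityˡ 1ℚ))

^-antitone : ∀ {d} → 0ℚ ≤ d → d ≤ 1ℚ → ∀ {k m} → k ℕ.≤ m → d ^ m ≤ d ^ k
^-antitone 0≤d d≤1 {zero}  {m}     z≤n       = ^-≤-1 0≤d d≤1 m
^-antitone {d} 0≤d d≤1 {suc k} {suc m} (s≤s k≤m) =
  QP.*-monoˡ-≤-nonNeg d {{nonNegative 0≤d}} (^-antitone 0≤d d≤1 k≤m)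

^-inverse : ∀ {c c⁻¹} → c⁻¹ * c ≡ 1ℚ → ∀ k → (c⁻¹ ^ k) * (c ^ k) ≡ 1ℚ
^-inverse c⁻¹c≡1 zero = refl
^-inverse {c} {c⁻¹} c⁻¹c≡1 (suc k) = begin
  (c⁻¹ * (c⁻¹ ^ k)) * (c * (c ^ k))   ≡⟨ solve 4 (λ a b x y → (a :* b) :* (x :* y) := (a :* x) :* (b :* y))
                                                 refl c⁻¹ (c⁻¹ ^ k) c (c ^ k) ⟩
  (c⁻¹ * c) * ((c⁻¹ ^ k) * (c ^ k))   ≡⟨ cong₂ _*_ c⁻¹c≡1 (^-inverse c⁻¹c≡1 k) ⟩
  1ℚ * 1ℚ                             ≡⟨ QP.*-identityˡ 1ℚ ⟩
  1ℚ                                  ∎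
  where open ≡-Reasoning

inv-*-cancel : ∀ d (d>0 : 0ℚ < d) → inv d d>0 * d ≡ 1ℚ
inv-*-cancel d d>0 = QP.*-inverseˡ d {{QP.pos⇒nonZero d {{positive d>0}}}}

inv-nonNeg : ∀ d (d>0 : 0ℚ < d) → 0ℚ ≤ inv d d>0
inv-nonNeg d d>0 = QP.<⇒≤ (QP.positive⁻¹ (inv d d>0) {{QP.1/pos⇒pos d {{positive d>0}}}})

sumOver : Subset N → (Fin N → ℕ) → ℕ
sumOver []      f = 0
sumOver (b ∷ S) f = (if b then f zero else 0) ℕ.+ sumOver S (f ∘ suc)

sumOver-≤ : ∀ (S : Subset N) (f : Fin N → ℕ) {m} → (∀ u → ℕ→ℚ (f u) ≤ m) → ℕ→ℚ (sumOver S f) ≤ ℕ→ℚ ∣ S ∣ * m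
sumOver-≤ []          f {m} f≤m = QP.≤-reflexive (sym (QP.*-zeroˡ m))
sumOver-≤ (false ∷ S) f     f≤m = sumOver-≤ S (f ∘ suc) (f≤m ∘ suc)
sumOver-≤ (true ∷ S)  f {m} f≤m = begin
  ℕ→ℚ (f zero ℕ.+ sumOver S (f ∘ suc))         ≡⟨ ℕ→ℚ-+ (f zero) _ ⟩
  ℕ→ℚ (f zero) + ℕ→ℚ (sumOver S (f ∘ suc))     ≤⟨ QP.+-mono-≤ (f≤m zero) (sumOver-≤ S (f ∘ suc) (f≤m ∘ suc)) ⟩
  m + ℕ→ℚ ∣ S ∣ * m                            ≡⟨ solve 2 (λ m k → m :+ k :* m := (con 1ℚ :+ k) :* m) refl m (ℕ→ℚ ∣ S ∣) ⟩
  (1ℚ + ℕ→ℚ ∣ S ∣) * m                         ≡⟨ cong (_* m) (ℕ→ℚ-+ 1 ∣ S ∣) ⟨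
  ℕ→ℚ (suc ∣ S ∣) * m                          ∎
  where open QP.≤-Reasoning

prodOver-zero : ∀ {u : Fin N} {S} (f : Fin N → ℚ) → u ∈ S → f u ≡ 0ℚ → prodOver S f ≡ 0ℚ
prodOver-zero {S = _ ∷ S} f here      fu≡0 rewrite fu≡0 = QP.*-zeroˡ (prodOver S (f ∘ suc))
prodOver-zero {S = b ∷ S} f (there u∈S) fu≡0 rewrite prodOver-zero (f ∘ suc) u∈S fu≡0 =
  QP.*-zeroʳ (if b then f zero else 1ℚ)

^-≤-prodOver : ∀ (S : Subset N) (f : Fin N → ℚ) {d} → 0ℚ ≤ d → (∀ u → u ∈ S → d ≤ f u) → d ^ ∣ S ∣ ≤ prodOver S f
^-≤-prodOver []          f 0≤d d≤f = QP.≤-refl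
^-≤-prodOver (false ∷ S) f 0≤d d≤f =
  QP.≤-trans (^-≤-prodOver S (f ∘ suc) 0≤d (λ u → d≤f (suc u) ∘ there)) (QP.≤-reflexive (sym (QP.*-identityˡ _)))
^-≤-prodOver (true ∷ S)  f 0≤d d≤f =
  *-mono-≤-nonNeg 0≤d (^-nonNeg 0≤d ∣ S ∣) (d≤f zero here)
    (^-≤-prodOver S (f ∘ suc) 0≤d (λ u → d≤f (suc u) ∘ there))

allIn-false : ∀ {u : Fin N} {S} (f : Fin N → Bool) → u ∈ S → f u ≡ false → allIn S f ≡ false
allIn-false f here        fu≡false rewrite fu≡false = refl
allIn-false {S = _ ∷ S} f (there u∈S) fu≡false rewrite allIn-false (f ∘ suc) u∈S fu≡false = ∧-zeroʳ _

allIn-⊥ : (f : Fin N → Bool) → allIn ⊥ f ≡ true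
allIn-⊥ {zero}  f = refl
allIn-⊥ {suc N} f = allIn-⊥ (f ∘ suc)

allIn-⁅⁆ : ∀ (x : Fin N) f → allIn ⁅ x ⁆ f ≡ f x
allIn-⁅⁆ zero    f rewrite allIn-⊥ (f ∘ suc) = ∧-identityʳ (f zero)
allIn-⁅⁆ (suc x) f = allIn-⁅⁆ x (f ∘ suc)

count-cong : {f g : Fin N → Bool} → (∀ v → f v ≡ g v) → count f ≡ count g
count-cong {zero}  f≗g = refl
count-cong {suc N} f≗g = cong₂ (λ b k → (if b then 1 else 0) ℕ.+ k) (f≗g zero) (count-cong (f≗g ∘ suc))

count-≤-+ : {f g h : Fin N → Bool} → (∀ v → f v ≡ true → g v ≡ true ⊎ h v ≡ true) → count f ℕ.≤ count g ℕ.+ count h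
count-≤-+ {zero}              cover = z≤n
count-≤-+ {suc N} {f} {g} {h} cover = ℕP.≤-trans
  (ℕP.+-mono-≤ (indicator-≤-+ (f zero) (g zero) (h zero) (cover zero)) (count-≤-+ (cover ∘ suc)))
  (ℕP.≤-reflexive (interchange (indicator (g zero)) (indicator (h zero)) (count (g ∘ suc)) (count (h ∘ suc))))
  where
  indicator : Bool → ℕ
  indicator b = if b then 1 else 0
  indicator-≤-+ : ∀ a b c → (a ≡ true → b ≡ true ⊎ c ≡ true) → indicator a ℕ.≤ indicator b ℕ.+ indicator c
  indicator-≤-+ false b     c     _   = z≤n
  indicator-≤-+ true  true  c     _   = s≤s z≤n
  indicator-≤-+ true  false true  _   = s≤s z≤n
  indicator-≤-+ true  false false a⇒b with a⇒b refl
  ... | inj₁ ()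
  ... | inj₂ ()

count-≡0 : (f : Fin N → Bool) → (∀ v → f v ≡ false) → count f ≡ 0
count-≡0 {zero}  f f≡false = refl
count-≡0 {suc N} f f≡false rewrite f≡false zero = count-≡0 (f ∘ suc) (f≡false ∘ suc)

count≡0⇒≡false : (f : Fin N → Bool) → count f ≡ 0 → ∀ v → f v ≡ false
count≡0⇒≡false f count≡0 zero with f zero
... | false = refl
count≡0⇒≡false f () zero | true
count≡0⇒≡false f count≡0 (suc v) with f zero
... | false = count≡0⇒≡false (f ∘ suc) count≡0 v
count≡0⇒≡false f () (suc v) | true

-- A union bound: a vertex counted on the left but not in the first term on the right
-- is a C-neighbour of some u ∈ S.
count-allIn-≤ : ∀ (S : Subset M) (p : Fin N → Bool) (A B C : Fin M → Fin N → Bool) →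
  (∀ u v → A u v ≡ true → B u v ≡ false → C u v ≡ true) →
  count (λ v → p v ∧ allIn S (λ u → A u v))
    ℕ.≤ count (λ v → p v ∧ allIn S (λ u → B u v)) ℕ.+ sumOver S (λ u → count (C u))
count-allIn-≤ []          p A B C cover = ℕP.m≤m+n _ 0
count-allIn-≤ (false ∷ S) p A B C cover = count-allIn-≤ S p (A ∘ suc) (B ∘ suc) (C ∘ suc) (cover ∘ suc)
count-allIn-≤ {N = N} (true ∷ S) p A B C cover = begin
  count (λ v → p v ∧ (A zero v ∧ restA v))     ≡⟨ count-cong (λ v → ∧-assoc (p v) _ _) ⟨
  count (λ v → (p v ∧ A zero v) ∧ restA v)
    ≤⟨ count-allIn-≤ S (λ v → p v ∧ A zero v) (A ∘ suc) (B ∘ suc) (C ∘ suc) (cover ∘ suc) ⟩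
  count (λ v → (p v ∧ A zero v) ∧ restB v) ℕ.+ Σ
    ≤⟨ ℕP.+-monoˡ-≤ Σ (count-≤-+ (λ v → covered (p v) (A zero v) (restB v) (B zero v) (C zero v) (cover zero v))) ⟩
  count (λ v → p v ∧ (B zero v ∧ restB v)) ℕ.+ count (C zero) ℕ.+ Σ
    ≡⟨ ℕP.+-assoc _ (count (C zero)) Σ ⟩
  count (λ v → p v ∧ (B zero v ∧ restB v)) ℕ.+ (count (C zero) ℕ.+ Σ) ∎
  where
  open ℕP.≤-Reasoning
  restA restB : Fin N → Bool
  restA v = allIn S (λ u → A (suc u) v)
  restB v = allIn S (λ u → B (suc u) v)
  Σ : ℕ
  Σ = sumOver S (λ u → count (C (suc u)))
  covered : ∀ p a r b c → (a ≡ true → b ≡ false → c ≡ true) → (p ∧ a) ∧ r ≡ true → p ∧ (b ∧ r) ≡ true ⊎ c ≡ true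
  covered true true true true  c _     _ = inj₁ refl
  covered true true true false c a¬b⇒c _ = inj₂ (a¬b⇒c refl refl)

commonNbrs-△-≤ : ∀ (G L : Graph N) (τ : Fin N → Fin t) S i →
  commonNbrs G τ S i ℕ.≤ commonNbrs (G △ L) τ S i ℕ.+ sumOver S (degree L)
commonNbrs-△-≤ G L τ S i =
  count-allIn-≤ S _ (adj G) (adj (G △ L)) (adj L) (λ u v → lost (adj G u v) (adj L u v))
  where
  lost : ∀ a l → a ≡ true → (a xor l) ≡ false → l ≡ true
  lost true true  _ _ = refl

△-commonNbrs-≤ : ∀ (G L : Graph N) (τ : Fin N → Fin t) S i →
  commonNbrs (G △ L) τ S i ℕ.≤ commonNbrs G τ S i ℕ.+ sumOver S (degree L)
△-commonNbrs-≤ G L τ S i =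
  count-allIn-≤ S _ (adj (G △ L)) (adj G) (adj L) (λ u v → gained (adj G u v) (adj L u v))
  where
  gained : ∀ a l → (a xor l) ≡ true → a ≡ false → l ≡ true
  gained false true _ _ = refl

commonNbrs-≡0 : ∀ (H : Graph N) (τ : Fin N → Fin t) {S u i} → u ∈ S →
  (∀ v → τ v ≡ i → adj H u v ≡ false) → commonNbrs H τ S i ≡ 0
commonNbrs-≡0 H τ {S} {u} {i} u∈S nonadj = count-≡0 _ noCommonNbr
  where
  noCommonNbr : ∀ v → isYes (τ v ≟ i) ∧ allIn S (λ w → adj H w v) ≡ false
  noCommonNbr v with τ v ≟ i
  ... | no  _    = refl
  ... | yes τv≡i = allIn-false (λ w → adj H w v) u∈S (nonadj v τv≡i)

typical⇒nonadjacent : ∀ (G : Graph N) (τ : Fin N → Fin t) ε {s} D → Typical G τ ε s D → 1 ℕ.≤ s →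
  ∀ {i x y} → D (τ x) i ≡ 0ℚ → τ y ≡ i → adj G x y ≡ false
typical⇒nonadjacent G τ ε {s} D typ 1≤s {i} {x} {y} Dxi≡0 τy≡i = begin
  adj G x y                                                 ≡⟨ allIn-⁅⁆ x (λ u → adj G u y) ⟨
  allIn ⁅ x ⁆ (λ u → adj G u y)                             ≡⟨ cong (_∧ allIn ⁅ x ⁆ (λ u → adj G u y)) yInVi ⟨
  isYes (τ y ≟ i) ∧ allIn ⁅ x ⁆ (λ u → adj G u y)           ≡⟨ count≡0⇒≡false _ noCommonNbrs y ⟩
  false                                                     ∎
  where
  open ≡-Reasoning
  yInVi : isYes (τ y ≟ i) ≡ true
  yInVi = trans (isYes≗does (τ y ≟ i)) (dec-true (τ y ≟ i) τy≡i)
  expected≡0 : ℕ→ℚ (partSize τ i) * prodOver ⁅ x ⁆ (λ u → D (τ u) i) ≡ 0ℚ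
  expected≡0 = trans (cong (ℕ→ℚ (partSize τ i) *_) (prodOver-zero _ (x∈⁅x⁆ x) Dxi≡0))
                     (QP.*-zeroʳ (ℕ→ℚ (partSize τ i)))
  noCommonNbrs : commonNbrs G τ ⁅ x ⁆ i ≡ 0
  noCommonNbrs = ℕP.n≤0⇒n≡0 (ℕ→ℚ-cancel-≤
    (≈zero±⇒≤0 ε expected≡0 (typ ⁅ x ⁆ (subst (ℕ._≤ s) (sym (∣⁅x⁆∣≡1 x)) 1≤s) i)))

△-commonNbrs-≡0 : ∀ (G L : Graph N) (τ : Fin N → Fin t) ε {s} D → Typical G τ ε s D →
  (∀ i j → HasEdgeBetween L τ i j → HasEdgeBetween G τ i j) →
  ∀ {S u i} → u ∈ S → ∣ S ∣ ℕ.≤ s → D (τ u) i ≡ 0ℚ → commonNbrs (G △ L) τ S i ≡ 0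
△-commonNbrs-≡0 G L τ ε {s} D typ L⊆G {S} {u} {i} u∈S ∣S∣≤s Dui≡0 =
  commonNbrs-≡0 (G △ L) τ u∈S nonadj△
  where
  1≤s : 1 ℕ.≤ s
  1≤s = ℕP.≤-trans (ℕP.≤-<-trans z≤n (x∈p⇒∣p-x∣<∣p∣ u∈S)) ∣S∣≤s
  nonadjL : ∀ v → τ v ≡ i → adj L u v ≡ false
  nonadjL v τv≡i with adj L u v in uv∈L
  ... | false = refl
  ... | true with L⊆G (τ u) i (u , v , refl , τv≡i , uv∈L)
  ... | x , y , τx≡τu , τy≡i , xy∈G
    with trans (sym xy∈G) (typical⇒nonadjacent G τ ε D typ 1≤s (trans (cong (λ k → D k i) τx≡τu) Dui≡0) τy≡i)
  ... | ()
  nonadj△ : ∀ v → τ v ≡ i → adj (G △ L) u v ≡ false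
  nonadj△ v τv≡i = cong₂ _xor_ (typical⇒nonadjacent G τ ε D typ 1≤s {x = u} Dui≡0 τv≡i) (nonadjL v τv≡i)

^-≤-expectedSize : ∀ (S : Subset N) (g : Fin N → ℚ) {d n P s} → 0ℚ ≤ d → d ≤ 1ℚ → 0ℚ ≤ n → ∣ S ∣ ℕ.≤ s →
  d * n ≤ P → (∀ u → u ∈ S → d ≤ g u) → d ^ suc s * n ≤ P * prodOver S g
^-≤-expectedSize S g {d} {n} {P} {s} 0≤d d≤1 0≤n ∣S∣≤s dn≤P d≤g = begin
  d * d ^ s * n        ≡⟨ solve 3 (λ a b c → (a :* b) :* c := b :* (a :* c)) refl d (d ^ s) n ⟩
  d ^ s * (d * n)      ≤⟨ *-mono-≤-nonNeg (^-nonNeg 0≤d s) (*-nonNeg 0≤d 0≤n) d^s≤prod dn≤P ⟩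
  prodOver S g * P     ≡⟨ QP.*-comm (prodOver S g) P ⟩
  P * prodOver S g     ∎
  where
  open QP.≤-Reasoning
  d^s≤prod : d ^ s ≤ prodOver S g
  d^s≤prod = QP.≤-trans (^-antitone 0≤d d≤1 ∣S∣≤s) (^-≤-prodOver S g 0≤d d≤g)

sumOver-≤-relative : ∀ (S : Subset N) (f : Fin N → ℕ) {s γ n c c⁻¹ b} → ∣ S ∣ ℕ.≤ s → 0ℚ ≤ γ → 0ℚ ≤ n →
  0ℚ ≤ c⁻¹ → c⁻¹ * c ≡ 1ℚ → c * n ≤ b → (∀ u → ℕ→ℚ (f u) ≤ γ * n) →
  ℕ→ℚ (sumOver S f) ≤ ℕ→ℚ s * γ * c⁻¹ * b
sumOver-≤-relative S f {s} {γ} {n} {c} {c⁻¹} {b} ∣S∣≤s 0≤γ 0≤n 0≤c⁻¹ c⁻¹c≡1 cn≤b f≤γn = begin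
  ℕ→ℚ (sumOver S f)    ≤⟨ sumOver-≤ S f f≤γn ⟩
  ℕ→ℚ ∣ S ∣ * (γ * n)  ≤⟨ QP.*-monoʳ-≤-nonNeg (γ * n) {{nonNegative (*-nonNeg 0≤γ 0≤n)}} (ℕ→ℚ-mono-≤ ∣S∣≤s) ⟩
  ℕ→ℚ s * (γ * n)      ≡⟨ QP.*-assoc (ℕ→ℚ s) γ n ⟨
  ℕ→ℚ s * γ * n        ≤⟨ *-≤-by-inverse (*-nonNeg (ℕ→ℚ-nonNeg s) 0≤γ) 0≤c⁻¹ c⁻¹c≡1 cn≤b ⟩
  ℕ→ℚ s * γ * c⁻¹ * b  ∎
  where open QP.≤-Reasoning

proposition3p11 : ∀ {N t : ℕ} (n ε γ d : ℚ) (s : ℕ) (n>0 : 0ℚ < n) (ε≥0 : 0ℚ ≤ ε) (γ≥0 : 0ℚ ≤ γ)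
    (d>0 : 0ℚ < d) (d≤1 : d ≤ 1ℚ)
    (G L : Graph N) (τ : Fin N → Fin t) (D : Fin t → Fin t → ℚ) →
    (∀ i j → D i j ≡ D j i) →
    (∀ i j → (0ℚ ≤ D i j) × (D i j ≤ 1ℚ)) →
    Typical G τ ε s D →
    (∀ i → (d * n ≤ ℕ→ℚ (partSize τ i)) × (ℕ→ℚ (partSize τ i) ≤ n)) →
    (∀ i j → (D i j ≡ 0ℚ) ⊎ (d ≤ D i j)) →
    (∀ i j → HasEdgeBetween L τ i j → HasEdgeBetween G τ i j) →
    (∀ v → ℕ→ℚ (degree L v) ≤ γ * n) →
    Typical (G △ L) τ (ε + ℕ→ℚ s * γ * (inv d d>0 ^ suc s)) s D
proposition3p11 n ε γ d s n>0 _ γ≥0 d>0 d≤1 G L τ D _ _ typ parts D≡0∨d≤D L⊆G degL≤γn S ∣S∣≤s i =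
  byDensity (any? (λ u → u ∈? S ×-dec D (τ u) i QP.≟ 0ℚ))
  where
  P = ℕ→ℚ (partSize τ i)
  p = prodOver S (λ u → D (τ u) i)
  δ = ℕ→ℚ s * γ * (inv d d>0 ^ suc s)
  cG = commonNbrs G τ S i
  cH = commonNbrs (G △ L) τ S i
  Σ = sumOver S (degree L)
  byDensity : Dec (∃ λ u → u ∈ S × D (τ u) i ≡ 0ℚ) → ℕ→ℚ cH ≈ P * p ± ((ε + δ) * (P * p))
  byDensity (yes (u , u∈S , Dui≡0)) = subst (λ k → ℕ→ℚ k ≈ P * p ± ((ε + δ) * (P * p)))
    (sym (△-commonNbrs-≡0 G L τ ε D typ L⊆G u∈S ∣S∣≤s Dui≡0))
    (≈±-zero (ε + δ) (trans (cong (P *_) (prodOver-zero _ u∈S Dui≡0)) (QP.*-zeroʳ P)))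
  byDensity (no ∄zero) = subst (_ ≈ P * p ±_) (sym (QP.*-distribʳ-+ (P * p) ε δ))
    (≈±-widen {b = P * p} {c = ε * (P * p)} (typ S ∣S∣≤s i)
      (ℕ→ℚ-mono-≤-+ cG Σ (△-commonNbrs-≤ G L τ S i)) (ℕ→ℚ-mono-≤-+ cH Σ (commonNbrs-△-≤ G L τ S i)) Σ≤δPp)
    where
    d≤D : ∀ u → u ∈ S → d ≤ D (τ u) i
    d≤D u u∈S with D≡0∨d≤D (τ u) i
    ... | inj₁ D≡0 = ⊥-elim (∄zero (u , u∈S , D≡0))
    ... | inj₂ d≤D = d≤D
    0≤n = QP.<⇒≤ n>0
    Σ≤δPp : ℕ→ℚ Σ ≤ δ * (P * p)
    Σ≤δPp = sumOver-≤-relative S (degree L) {c = d ^ suc s} {c⁻¹ = inv d d>0 ^ suc s} ∣S∣≤s γ≥0 0≤n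
      (^-nonNeg (inv-nonNeg d d>0) (suc s)) (^-inverse {d} {inv d d>0} (inv-*-cancel d d>0) (suc s))
      (^-≤-expectedSize S _ (QP.<⇒≤ d>0) d≤1 0≤n ∣S∣≤s (proj₁ (parts i)) d≤D) degL≤γn
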